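{- Let $m\geq 3$ be an integer. Suppose there are $k$ circuits $x^1,\dots,x^k$ of $(1,1,1)^{(m)}$ admitting a primitive relation $\sum_{i=1}^k h_i x^i=0$ with $x^k=(a,u_{m-2},b,u_{m-1},c,u_m)$ and $h_k$ odd. Then there are $k+2$ circuits $\bar x^1,\dots,\bar x^{k+2}$ of $(1,1,1)^{(m+1)}$ admitting a primitive relation $\sum_{i=1}^{k+2}\bar h_i\bar x^i=0$ with $\bar x^{k+2}=(a,u_{m-1},b,u_m,c,u_{m+1})$ and $\bar h_{k+2}$ odd, where $\bar h_i=2h_i$ for $i=1,\dots,k-1$ and $\bar h_{k+2}=\bar h_{k+1}=\bar h_k=h_k$.
   Context: For a positive integer $m$, let $K_{3,m}$ be the complete bipartite graph with vertex set $\{a,b,c\}\uplus\{u_1,\dots,u_m\}$ and edge set $\{a,b,c\}\times\{u_1,\dots,u_m\}$, and let $(1,1,1)^{(m)}$ be its $(3+m)\times 3m$ vertex-edge incidence matrix (rows indexed by vertices, columns by edges). A circuit of an integer matrix $B$ is a nonzero integer vector $x$ with $Bx=0$ whose support is inclusion-minimal among such vectors and whose nonzero entries are relatively prime. Circuits of $(1,1,1)^{(m)}$ are exactly the functions on the edges of $K_{3,m}$ supported on the edge set of a cycle of $K_{3,m}$ and alternating in values $\pm1$ along it; the notation $(v_1,v_2,\dots,v_l)$ denotes the circuit supported on the cycle $v_1,v_2,\dots,v_l,v_1$ whose value is $+1$ on the edge $\{v_1,v_2\}$ (and hence alternates $+1,-1,\dots$ along consecutive edges of the cycle). A linear relation $\sum_{i=1}^k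 h_iv^i=0$ on integer vectors $v^1,\dots,v^k$ is primitive if $h_1,\dots,h_k$ are relatively prime positive integers and no $k-1$ of the $v^i$ satisfy any nontrivial linear relation. -}

module Defs where

open import Data.Nat using (ℕ; zero; suc; _<_)
open import Data.Nat.Divisibility using (_∣_)
open import Data.Integer as ℤ using (ℤ; +_; -_; _+_; _-_; _*_)
open import Data.Fin as Fin using (Fin; zero; suc; inject₁; fromℕ)
open import Data.Product using (_×_; _,_; ∃)
open import Data.Sum using (_⊎_; inj₁; inj₂)
open import Data.Bool using (if_then_else_)
open import Relation.Nullary using (¬_)
open import Relation.Nullary.Decidable using (⌊_⌋)
open import Relation.Binary.PropositionalEquality using (_≡_; _≢_)

∑ : (n : ℕ) → (Fin n → ℤ) → ℤ
∑ zero    f = + 0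
∑ (suc n) f = f zero + ∑ n (λ i → f (suc i))

-- K_{3,m}: vertices {a,b,c} ⊎ {u_1..u_m}; a,b,c = Fin 3 indices 0,1,2,
-- u_j = index j-1 in Fin m.  Edges: {a,b,c} × {u_1..u_m}.
Vertex : ℕ → Set
Vertex m = Fin 3 ⊎ Fin m

Edge : ℕ → Set
Edge m = Fin 3 × Fin m

EVec : ℕ → Set
EVec m = Edge m → ℤ

δ : ∀ {n} → Fin n → Fin n → ℤ
δ i j = if ⌊ i Fin.≟ j ⌋ then + 1 else + 0

incidence : (m : ℕ) → Vertex m → Edge m → ℤ
incidence m (inj₁ v) (i , j) = δ v i
incidence m (inj₂ u) (i , j) = δ u j

InKernel : (m : ℕ) → EVec m → Set
InKernel m x = ∀ (v : Vertex m) →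
  ∑ 3 (λ i → ∑ m (λ j → incidence m v (i , j) * x (i , j))) ≡ + 0

NonZeroVec : ∀ {m} → EVec m → Set
NonZeroVec x = ∃ λ e → x e ≢ + 0

SuppSub : ∀ {m} → EVec m → EVec m → Set
SuppSub y x = ∀ e → x e ≡ + 0 → y e ≡ + 0

EntriesCoprime : ∀ {m} → EVec m → Set
EntriesCoprime x = ∀ (d : ℕ) → (∀ e → d ∣ (ℤ.∣ x e ∣)) → d ≡ 1

IsCircuit : (m : ℕ) → EVec m → Set
IsCircuit m x =
  InKernel m x × NonZeroVec x ×
  (∀ y → InKernel m y → NonZeroVec y → SuppSub y x → SuppSub x y) ×
  EntriesCoprime x

PosCoprime : (k : ℕ) → (Fin k → ℕ) → Set
PosCoprime k h = (∀ i → 0 < h i) × (∀ (d : ℕ) → (∀ i → d ∣ h i) → d ≡ 1)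

lincomb : ∀ {m} (k : ℕ) → (Fin k → ℤ) → (Fin k → EVec m) → EVec m
lincomb k c v e = ∑ k (λ i → c i * v i e)

PrimitiveRelation : (m k : ℕ) → (Fin k → EVec m) → (Fin k → ℕ) → Set
PrimitiveRelation m k v h =
  PosCoprime k h ×
  (∀ e → lincomb k (λ i → + h i) v e ≡ + 0) ×
  -- no k-1 of the v^i satisfy a nontrivial linear relation:
  -- for each omitted index j, any relation among the others is trivial
  (∀ (j : Fin k) (c : Fin k → ℤ) → c j ≡ + 0 →
     (∀ e → lincomb k c v e ≡ + 0) → ∀ i → c i ≡ + 0)

-- the circuit (a, u_{j1}, b, u_{j2}, c, u_{j3}) (j's are 0-based Fin m indices)
cyc : ∀ {m} → Fin m → Fin m → Fin m → EVec m
cyc j1 j2 j3 (i , j) =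
    δ i zero * δ j j1 - δ i (suc zero) * δ j j1
  + δ i (suc zero) * δ j j2 - δ i (suc (suc zero)) * δ j j2
  + δ i (suc (suc zero)) * δ j j3 - δ i zero * δ j j3

Odd : ℕ → Set
Odd n = ¬ (2 ∣ n)

module Submission where

-- Insert a new vertex v into K_{3,m} at the index of u_{m−1}.  The first
-- k−1 circuits stay circuits (with an empty column at v).  The last circuit is
-- half the sum of the three cycles obtained from it by rerouting one of its
-- u-vertices through v; these replace it, the last of them being
-- (a,u_{m−1},b,u_m,c,u_{m+1}) in the new numbering.  Doubling the old weights and
-- giving weight h_k to each new cycle yields a relation.  It is primitive: the
-- column of v forces equal weights α on the three new cycles, so any relation of
-- the new family collapses to a relation of the old one (last weight 2α); and the
-- new weights are coprime because h_k is odd.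

open import Defs

module Circuits where

  open import Data.Nat as ℕ using (ℕ; zero; suc)
  open import Data.Integer as ℤ using (ℤ; +_; -_; _+_; _-_; _*_)
  open import Data.Integer.Tactic.RingSolver using (solve-∀)
  open import Data.Integer.Solver using (module +-*-Solver)
  import Data.Integer.Properties as ℤP
  import Data.Nat.Properties as ℕP
  open import Data.Fin as Fin using (Fin; zero; suc; inject₁; fromℕ; punchIn; punchOut)
  import Data.Fin.Relation.Unary.Top as Top
  open Top using (‵fromℕ; ‵inj₁; ‵inject₁)
  open import Data.Fin.Properties using (suc-injective; punchInᵢ≢i; punchIn-injective; punchIn-punchOut)
  open import Data.Vec.Functional using (Vector; insertAt; removeAt)
  open import Data.Vec.Functional.Properties using (insertAt-lookup; insertAt-punchIn)
  open import Data.Product using (_×_; _,_; ∃; proj₁; proj₂)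
  open import Data.Sum using (inj₁; inj₂)
  open import Function using (_∘_)
  open import Relation.Nullary using (yes; no; contradiction)
  open import Relation.Binary.PropositionalEquality
  open import Algebra.Properties.Semiring.Sum ℤP.+-*-semiring
    using (sum; sum-cong-≗; sum-replicate-zero; sum-remove; sum-init-last; *-distribˡ-sum)

  open import Algebra.Properties.AbelianGroup ℤP.+-0-abelianGroup using (inverseˡ-unique; inverseʳ-unique)
  open import Data.Nat.Divisibility using (_∣_; ∣1⇒≡1; ∣⇒≤; 0∣⇒≡0; ∣-trans)
  open import Data.Nat.Coprimality using (Coprime; coprime-divisor)

  open ≡-Reasoning

  ∑≡sum : ∀ n (f : Fin n → ℤ) → ∑ n f ≡ sum f
  ∑≡sum zero    f = refl
  ∑≡sum (suc n) f = cong (_+_ (f zero)) (∑≡sum n (f ∘ suc))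

  ∑-cong : ∀ n {f g : Fin n → ℤ} → (∀ i → f i ≡ g i) → ∑ n f ≡ ∑ n g
  ∑-cong n {f} {g} f≗g = begin
    ∑ n f   ≡⟨ ∑≡sum n f ⟩
    sum f   ≡⟨ sum-cong-≗ f≗g ⟩
    sum g   ≡⟨ ∑≡sum n g ⟨
    ∑ n g   ∎

  ∑-zero : ∀ n {f : Fin n → ℤ} → (∀ i → f i ≡ + 0) → ∑ n f ≡ + 0
  ∑-zero n {f} f≗0 = trans (∑-cong n f≗0) (trans (∑≡sum n _) (sum-replicate-zero n))

  ∑-remove : ∀ n (w : Fin (suc n)) (f : Fin (suc n) → ℤ) →
    ∑ (suc n) f ≡ f w + ∑ n (f ∘ punchIn w)
  ∑-remove n w f = begin
    ∑ (suc n) f               ≡⟨ ∑≡sum (suc n) f ⟩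
    sum f                     ≡⟨ sum-remove f ⟩
    f w + sum (removeAt f w)  ≡⟨ cong (_+_ (f w)) (∑≡sum n (f ∘ punchIn w)) ⟨
    f w + ∑ n (f ∘ punchIn w) ∎

  ∑-last : ∀ n (f : Fin (suc n) → ℤ) → ∑ (suc n) f ≡ ∑ n (f ∘ inject₁) + f (fromℕ n)
  ∑-last n f = begin
    ∑ (suc n) f                   ≡⟨ ∑≡sum (suc n) f ⟩
    sum f                         ≡⟨ sum-init-last f ⟩
    sum (f ∘ inject₁) + f (fromℕ n) ≡⟨ cong (_+ f (fromℕ n)) (∑≡sum n (f ∘ inject₁)) ⟨
    ∑ n (f ∘ inject₁) + f (fromℕ n) ∎

  ∑-scale : ∀ n (a : ℤ) (f : Fin n → ℤ) → ∑ n (λ i → a * f i) ≡ a * ∑ n f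
  ∑-scale n a f = begin
    ∑ n (λ i → a * f i)   ≡⟨ ∑≡sum n _ ⟩
    sum (λ i → a * f i)   ≡⟨ *-distribˡ-sum a f ⟨
    a * sum f             ≡⟨ cong (a *_) (∑≡sum n f) ⟨
    a * ∑ n f             ∎

  ∑-single : ∀ n (a : Fin n) (f : Fin n → ℤ) → (∀ j → j ≢ a → f j ≡ + 0) → ∑ n f ≡ f a
  ∑-single (suc n) a f off = begin
    ∑ (suc n) f                ≡⟨ ∑-remove n a f ⟩
    f a + ∑ n (f ∘ punchIn a)  ≡⟨ cong (_+_ (f a)) (∑-zero n (λ j → off (punchIn a j) (punchInᵢ≢i a j))) ⟩
    f a + + 0                  ≡⟨ ℤP.+-identityʳ (f a) ⟩
    f a                        ∎

  ∑-pair : ∀ n (a b : Fin n) (f : Fin n → ℤ) → a ≢ b →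
    (∀ j → j ≢ a → j ≢ b → f j ≡ + 0) → ∑ n f ≡ f a + f b
  ∑-pair (suc n) a b f a≢b off = begin
    ∑ (suc n) f                ≡⟨ ∑-remove n a f ⟩
    f a + ∑ n (f ∘ punchIn a)  ≡⟨ cong (_+_ (f a)) (∑-single n b′ (f ∘ punchIn a) off′) ⟩
    f a + f (punchIn a b′)     ≡⟨ cong (λ j → f a + f j) (punchIn-punchOut a≢b) ⟩
    f a + f b                  ∎
    where
    b′ : Fin n
    b′ = punchOut a≢b
    off′ : ∀ j → j ≢ b′ → f (punchIn a j) ≡ + 0
    off′ j j≢b′ = off (punchIn a j) (punchInᵢ≢i a j)
      (λ eq → j≢b′ (punchIn-injective a j b′ (trans eq (sym (punchIn-punchOut a≢b)))))

  δ-refl : ∀ {n} (i : Fin n) → δ i i ≡ + 1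
  δ-refl i with i Fin.≟ i
  ... | yes _   = refl
  ... | no i≢i = contradiction refl i≢i

  δ-≢ : ∀ {n} {i j : Fin n} → i ≢ j → δ i j ≡ + 0
  δ-≢ {i = i} {j} i≢j with i Fin.≟ j
  ... | yes i≡j = contradiction i≡j i≢j
  ... | no _    = refl

  δ-punchIn : ∀ {n} (w : Fin (suc n)) (i j : Fin n) → δ (punchIn w i) (punchIn w j) ≡ δ i j
  δ-punchIn w i j with i Fin.≟ j
  ... | yes refl = δ-refl (punchIn w i)
  ... | no i≢j = δ-≢ (i≢j ∘ punchIn-injective w i j)

  δ-new : ∀ {n} (w : Fin (suc n)) (j : Fin n) → δ w (punchIn w j) ≡ + 0
  δ-new w j = δ-≢ (punchInᵢ≢i w j ∘ sym)

  ∑-δ : ∀ n (r : Fin n) (g : Fin n → ℤ) → ∑ n (λ i → δ r i * g i) ≡ g r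
  ∑-δ n r g = begin
    ∑ n (λ i → δ r i * g i) ≡⟨ ∑-single n r _ (λ i i≢r → cong (_* g i) (δ-≢ (i≢r ∘ sym))) ⟩
    δ r r * g r             ≡⟨ cong (_* g r) (δ-refl r) ⟩
    + 1 * g r               ≡⟨ ℤP.*-identityˡ (g r) ⟩
    g r                     ∎

  -- Membership in the kernel of (1,1,1)^(m) means: every row (edges at one of
  -- a, b, c) and every column (edges at one u_j) of the edge vector sums to zero.
  RowSums : (m : ℕ) → EVec m → Set
  RowSums m x = ∀ r → ∑ m (λ j → x (r , j)) ≡ + 0

  ColumnSums : (m : ℕ) → EVec m → Set
  ColumnSums m x = ∀ u → ∑ 3 (λ i → x (i , u)) ≡ + 0

  incidence-row : ∀ m (x : EVec m) r →
    ∑ 3 (λ i → ∑ m (λ j → incidence m (inj₁ r) (i , j) * x (i , j))) ≡ ∑ m (λ j → x (r , j))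
  incidence-row m x r = begin
    ∑ 3 (λ i → ∑ m (λ j → δ r i * x (i , j)))  ≡⟨ ∑-cong 3 (λ i → ∑-scale m (δ r i) (λ j → x (i , j))) ⟩
    ∑ 3 (λ i → δ r i * ∑ m (λ j → x (i , j)))  ≡⟨ ∑-δ 3 r (λ i → ∑ m (λ j → x (i , j))) ⟩
    ∑ m (λ j → x (r , j))                      ∎

  incidence-column : ∀ m (x : EVec m) u →
    ∑ 3 (λ i → ∑ m (λ j → incidence m (inj₂ u) (i , j) * x (i , j))) ≡ ∑ 3 (λ i → x (i , u))
  incidence-column m x u = ∑-cong 3 (λ i → ∑-δ m u (λ j → x (i , j)))

  kernel⇒rowSums : ∀ m (x : EVec m) → InKernel m x → RowSums m x
  kernel⇒rowSums m x Bx≡0 r = trans (sym (incidence-row m x r)) (Bx≡0 (inj₁ r))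

  kernel⇒columnSums : ∀ m (x : EVec m) → InKernel m x → ColumnSums m x
  kernel⇒columnSums m x Bx≡0 u = trans (sym (incidence-column m x u)) (Bx≡0 (inj₂ u))

  sums⇒kernel : ∀ m (x : EVec m) → RowSums m x → ColumnSums m x → InKernel m x
  sums⇒kernel m x rows cols (inj₁ r) = trans (incidence-row m x r) (rows r)
  sums⇒kernel m x rows cols (inj₂ u) = trans (incidence-column m x u) (cols u)

  -- Entry (i , u) of the cycle (a, u_{j1}, b, u_{j2}, c, u_{j3}) is
  -- cycEntry i (δ u j1) (δ u j2) (δ u j3), by the definition of cyc.
  cycEntry : Fin 3 → ℤ → ℤ → ℤ → ℤ
  cycEntry i p q r = δ i zero * p - δ i (suc zero) * p + δ i (suc zero) * q
    - δ i (suc (suc zero)) * q + δ i (suc (suc zero)) * r - δ i zero * r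

  cycEntry-cong : ∀ i {p p′ q q′ r r′} → p ≡ p′ → q ≡ q′ → r ≡ r′ →
    cycEntry i p q r ≡ cycEntry i p′ q′ r′
  cycEntry-cong i refl refl refl = refl

  -- The same entry as a polynomial expression, for the ring solver.
  cycPoly : ∀ {n} → (A B C p q r : +-*-Solver.Polynomial n) → +-*-Solver.Polynomial n
  cycPoly A B C p q r = A :* p :- B :* p :+ B :* q :- C :* q :+ C :* r :- A :* r
    where open +-*-Solver

  -- A column other than the three columns of a cycle is empty.
  cycEntry-zero : ∀ i → cycEntry i (+ 0) (+ 0) (+ 0) ≡ + 0
  cycEntry-zero i = solve 3 (λ A B C → cycPoly A B C (con (+ 0)) (con (+ 0)) (con (+ 0)) := con (+ 0)) refl
    (δ i zero) (δ i (suc zero)) (δ i (suc (suc zero)))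
    where open +-*-Solver

  -- Splitting: replacing in turn each of the columns j1, j2, j3 of a cycle by a
  -- column w and adding up gives twice the cycle (the entries in column w cancel).
  cyc-split : ∀ {m} (w j1 j2 j3 : Fin m) e →
    cyc j1 w j3 e + cyc j1 j2 w e + cyc w j2 j3 e ≡ + 2 * cyc j1 j2 j3 e
  cyc-split w j1 j2 j3 (i , u) =
    solve 7 (λ A B C W P Q R → cycPoly A B C P W R :+ cycPoly A B C P Q W :+ cycPoly A B C W Q R
                                := con (+ 2) :* cycPoly A B C P Q R) refl
      (δ i zero) (δ i (suc zero)) (δ i (suc (suc zero))) (δ u w) (δ u j1) (δ u j2) (δ u j3)
    where open +-*-Solver

  -- Row i of the cycle (a, u_{j1}, b, u_{j2}, c, u_{j3}) has the entry +1 in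
  -- column `plus i`, the entry −1 in column `minus i`, and zeros elsewhere.
  module Cycle {m : ℕ} (j1 j2 j3 : Fin m) where

    plus minus : Fin 3 → Fin m
    plus zero             = j1
    plus (suc zero)       = j2
    plus (suc (suc zero)) = j3
    minus zero             = j3
    minus (suc zero)       = j1
    minus (suc (suc zero)) = j2

    -- the row whose −1 lies in the column of the +1 of row i
    next : Fin 3 → Fin 3
    next zero             = suc zero
    next (suc zero)       = suc (suc zero)
    next (suc (suc zero)) = zero

    minus-next : ∀ i → minus (next i) ≡ plus i
    minus-next zero             = refl
    minus-next (suc zero)       = refl
    minus-next (suc (suc zero)) = refl

    cyc-entry : ∀ i u → cyc j1 j2 j3 (i , u) ≡ δ u (plus i) - δ u (minus i)
    cyc-entry zero             u = row-a (δ u j1) (δ u j2) (δ u j3)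
      where row-a : ∀ p q r → + 1 * p - + 0 * p + + 0 * q - + 0 * q + + 0 * r - + 1 * r ≡ p - r
            row-a = solve-∀
    cyc-entry (suc zero)       u = row-b (δ u j1) (δ u j2) (δ u j3)
      where row-b : ∀ p q r → + 0 * p - + 1 * p + + 1 * q - + 0 * q + + 0 * r - + 0 * r ≡ q - p
            row-b = solve-∀
    cyc-entry (suc (suc zero)) u = row-c (δ u j1) (δ u j2) (δ u j3)
      where row-c : ∀ p q r → + 0 * p - + 0 * p + + 0 * q - + 1 * q + + 1 * r - + 0 * r ≡ r - q
            row-c = solve-∀

    cyc-columnSums : ColumnSums m (cyc j1 j2 j3)
    cyc-columnSums u = trans (∑-cong 3 (λ i → cyc-entry i u)) (cancel (δ u j1) (δ u j2) (δ u j3))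
      where cancel : ∀ p q r → p - r + (q - p + (r - q + + 0)) ≡ + 0
            cancel = solve-∀

    module _ (j1≢j2 : j1 ≢ j2) (j2≢j3 : j2 ≢ j3) (j1≢j3 : j1 ≢ j3) where

      private
        x : EVec m
        x = cyc j1 j2 j3

      plus≢minus : ∀ i → plus i ≢ minus i
      plus≢minus zero             = j1≢j3
      plus≢minus (suc zero)       = j1≢j2 ∘ sym
      plus≢minus (suc (suc zero)) = j2≢j3 ∘ sym

      entry-plus : ∀ i → x (i , plus i) ≡ + 1
      entry-plus i = trans (cyc-entry i (plus i)) (cong₂ _-_ (δ-refl (plus i)) (δ-≢ (plus≢minus i)))

      entry-minus : ∀ i → x (i , minus i) ≡ - + 1
      entry-minus i = trans (cyc-entry i (minus i)) (cong₂ _-_ (δ-≢ (plus≢minus i ∘ sym)) (δ-refl (minus i)))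

      entry-off : ∀ i u → u ≢ plus i → u ≢ minus i → x (i , u) ≡ + 0
      entry-off i u u≢plus u≢minus = trans (cyc-entry i u) (cong₂ _-_ (δ-≢ u≢plus) (δ-≢ u≢minus))

      cyc-kernel : InKernel m x
      cyc-kernel = sums⇒kernel m x rows cyc-columnSums
        where
        rows : RowSums m x
        rows r = trans (∑-pair m (plus r) (minus r) _ (plus≢minus r) (entry-off r))
                       (cong₂ _+_ (entry-plus r) (entry-minus r))

      -- A kernel vector supported inside the cycle is a multiple of it: its
      -- balanced rows and columns propagate the value t at (a, u_{j1}) around the cycle.
      multiple-of-cyc : ∀ y → InKernel m y → SuppSub y x → ∀ e → y e ≡ y (zero , j1) * x e
      multiple-of-cyc y y-ker y⊆x (i , u) = shape i u
        where
        t : ℤ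
        t = y (zero , j1)
        off : ∀ i u → u ≢ plus i → u ≢ minus i → y (i , u) ≡ + 0
        off i u u≢plus u≢minus = y⊆x (i , u) (entry-off i u u≢plus u≢minus)
        row-balance : ∀ i → y (i , plus i) + y (i , minus i) ≡ + 0
        row-balance i = trans (sym (∑-pair m (plus i) (minus i) _ (plus≢minus i) (off i)))
                              (kernel⇒rowSums m y y-ker i)
        -- the column of the +1 of row i meets the third row in a zero entry
        column-balance : ∀ i → y (i , plus i) + y (next i , plus i) ≡ + 0
        column-balance zero =
          drop-r (y (zero , j1)) (y (suc zero , j1)) _ (off (suc (suc zero)) j1 j1≢j3 j1≢j2) (kernel⇒columnSums m y y-ker j1)
          where drop-r : ∀ p q r → r ≡ + 0 → p + (q + (r + + 0)) ≡ + 0 → p + q ≡ + 0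
                drop-r p q r refl = trans (ring p q)
                  where ring : ∀ p q → p + q ≡ p + (q + (+ 0 + + 0))
                        ring = solve-∀
        column-balance (suc zero) =
          drop-p _ (y (suc zero , j2)) (y (suc (suc zero) , j2))
                 (off zero j2 (j1≢j2 ∘ sym) j2≢j3) (kernel⇒columnSums m y y-ker j2)
          where drop-p : ∀ p q r → p ≡ + 0 → p + (q + (r + + 0)) ≡ + 0 → q + r ≡ + 0
                drop-p p q r refl = trans (ring q r)
                  where ring : ∀ q r → q + r ≡ + 0 + (q + (r + + 0))
                        ring = solve-∀
        column-balance (suc (suc zero)) =
          drop-q (y (zero , j3)) _ (y (suc (suc zero) , j3))
                 (off (suc zero) j3 (j2≢j3 ∘ sym) (j1≢j3 ∘ sym)) (kernel⇒columnSums m y y-ker j3)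
          where drop-q : ∀ p q r → q ≡ + 0 → p + (q + (r + + 0)) ≡ + 0 → r + p ≡ + 0
                drop-q p q r refl = trans (ring p r)
                  where ring : ∀ p r → r + p ≡ p + (+ 0 + (r + + 0))
                        ring = solve-∀
        plus-next : ∀ i → y (next i , plus (next i)) ≡ y (i , plus i)
        plus-next i = begin
          y (next i , plus (next i))   ≡⟨ inverseˡ-unique _ _ (row-balance (next i)) ⟩
          - y (next i , minus (next i)) ≡⟨ cong (λ u → - y (next i , u)) (minus-next i) ⟩
          - y (next i , plus i)         ≡⟨ cong -_ (inverseʳ-unique _ _ (column-balance i)) ⟩
          - - y (i , plus i)            ≡⟨ ℤP.neg-involutive _ ⟩
          y (i , plus i)                ∎
        plus-entry : ∀ i → y (i , plus i) ≡ t
        plus-entry zero             = refl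
        plus-entry (suc zero)       = plus-next zero
        plus-entry (suc (suc zero)) = trans (plus-next (suc zero)) (plus-next zero)
        shape : ∀ i u → y (i , u) ≡ t * x (i , u)
        shape i u with u Fin.≟ plus i | u Fin.≟ minus i
        ... | yes refl | _ = begin
          y (i , plus i)  ≡⟨ plus-entry i ⟩
          t               ≡⟨ ℤP.*-identityʳ t ⟨
          t * + 1         ≡⟨ cong (t *_) (entry-plus i) ⟨
          t * x (i , u)   ∎
        ... | no _ | yes refl = begin
          y (i , minus i)    ≡⟨ inverseʳ-unique _ _ (row-balance i) ⟩
          - y (i , plus i)   ≡⟨ cong -_ (plus-entry i) ⟩
          - t                ≡⟨ cong -_ (ℤP.*-identityʳ t) ⟨
          - (t * + 1)        ≡⟨ ℤP.neg-distribʳ-* t (+ 1) ⟩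
          t * - + 1          ≡⟨ cong (t *_) (entry-minus i) ⟨
          t * x (i , u)      ∎
        ... | no u≢plus | no u≢minus = begin
          y (i , u)       ≡⟨ off i u u≢plus u≢minus ⟩
          + 0             ≡⟨ ℤP.*-zeroʳ t ⟨
          t * + 0         ≡⟨ cong (t *_) (entry-off i u u≢plus u≢minus) ⟨
          t * x (i , u)   ∎

      cyc-isCircuit : IsCircuit m x
      cyc-isCircuit = cyc-kernel , ((zero , j1) , nonzero) , minimal , coprime
        where
        nonzero : x (zero , j1) ≢ + 0
        nonzero eq with trans (sym (entry-plus zero)) eq
        ... | ()
        minimal : ∀ y → InKernel m y → NonZeroVec y → SuppSub y x → SuppSub x y
        minimal y y-ker ((i₀ , u₀) , y₀≢0) y⊆x e ye≡0
          with ℤP.i*j≡0⇒i≡0∨j≡0 (y (zero , j1)) (trans (sym (multiple-of-cyc y y-ker y⊆x e)) ye≡0)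
        ... | inj₂ xe≡0 = xe≡0
        ... | inj₁ t≡0  = contradiction (begin
          y (i₀ , u₀)                      ≡⟨ multiple-of-cyc y y-ker y⊆x (i₀ , u₀) ⟩
          y (zero , j1) * x (i₀ , u₀)      ≡⟨ cong (_* x (i₀ , u₀)) t≡0 ⟩
          + 0 * x (i₀ , u₀)                ≡⟨ ℤP.*-zeroˡ (x (i₀ , u₀)) ⟩
          + 0                              ∎) y₀≢0
        coprime : EntriesCoprime x
        coprime d d∣x = ∣1⇒≡1 (subst (λ v → d ∣ ℤ.∣ v ∣) (entry-plus zero) (d∣x (zero , j1)))

  -- Inserting an all-zero column at position w: the edge vector on K_{3,m} seen
  -- on K_{3,m+1}, where the new vertex (at index w) carries no edge.
  insertColumn : ∀ {m} → Fin (suc m) → EVec m → EVec (suc m)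
  insertColumn w x (i , u) = insertAt (λ j → x (i , j)) w (+ 0) u

  insertColumn-new : ∀ {m} w (x : EVec m) i → insertColumn w x (i , w) ≡ + 0
  insertColumn-new w x i = insertAt-lookup (λ j → x (i , j)) w (+ 0)

  insertColumn-old : ∀ {m} w (x : EVec m) i j → insertColumn w x (i , punchIn w j) ≡ x (i , j)
  insertColumn-old w x i j = insertAt-punchIn (λ j → x (i , j)) w (+ 0) j

  deleteColumn : ∀ {m} → Fin (suc m) → EVec (suc m) → EVec m
  deleteColumn w y (i , j) = y (i , punchIn w j)

  data ColumnView {m : ℕ} (w : Fin (suc m)) : Fin (suc m) → Set where
    new : ColumnView w w
    old : (j : Fin m) → ColumnView w (punchIn w j)

  columnView : ∀ {m} (w u : Fin (suc m)) → ColumnView w u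
  columnView w u with w Fin.≟ u
  ... | yes refl = new
  ... | no w≢u  = subst (ColumnView w) (punchIn-punchOut w≢u) (old (punchOut w≢u))

  insertColumn-kernel : ∀ m w (x : EVec m) → InKernel m x → InKernel (suc m) (insertColumn w x)
  insertColumn-kernel m w x x-ker = sums⇒kernel (suc m) (insertColumn w x) rows cols
    where
    rows : RowSums (suc m) (insertColumn w x)
    rows r = begin
      ∑ (suc m) (λ u → insertColumn w x (r , u))
        ≡⟨ ∑-remove m w (λ u → insertColumn w x (r , u)) ⟩
      insertColumn w x (r , w) + ∑ m (λ j → insertColumn w x (r , punchIn w j))
        ≡⟨ cong₂ _+_ (insertColumn-new w x r) (∑-cong m (insertColumn-old w x r)) ⟩
      + 0 + ∑ m (λ j → x (r , j))
        ≡⟨ ℤP.+-identityˡ _ ⟩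
      ∑ m (λ j → x (r , j))
        ≡⟨ kernel⇒rowSums m x x-ker r ⟩
      + 0 ∎
    cols : ColumnSums (suc m) (insertColumn w x)
    cols u with columnView w u
    ... | new   = ∑-zero 3 (insertColumn-new w x)
    ... | old j = trans (∑-cong 3 (λ i → insertColumn-old w x i j)) (kernel⇒columnSums m x x-ker j)

  deleteColumn-kernel : ∀ m w (y : EVec (suc m)) → InKernel (suc m) y →
    (∀ i → y (i , w) ≡ + 0) → InKernel m (deleteColumn w y)
  deleteColumn-kernel m w y y-ker y-w≡0 = sums⇒kernel m (deleteColumn w y) rows cols
    where
    rows : RowSums m (deleteColumn w y)
    rows r = begin
      ∑ m (λ j → y (r , punchIn w j))               ≡⟨ ℤP.+-identityˡ _ ⟨
      + 0 + ∑ m (λ j → y (r , punchIn w j))         ≡⟨ cong (_+ ∑ m (λ j → y (r , punchIn w j))) (y-w≡0 r) ⟨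
      y (r , w) + ∑ m (λ j → y (r , punchIn w j))   ≡⟨ ∑-remove m w (λ u → y (r , u)) ⟨
      ∑ (suc m) (λ u → y (r , u))                   ≡⟨ kernel⇒rowSums (suc m) y y-ker r ⟩
      + 0                                           ∎
    cols : ColumnSums m (deleteColumn w y)
    cols j = kernel⇒columnSums (suc m) y y-ker (punchIn w j)

  insertColumn-isCircuit : ∀ m w (x : EVec m) → IsCircuit m x → IsCircuit (suc m) (insertColumn w x)
  insertColumn-isCircuit m w x (x-ker , ((i , j) , xij≢0) , x-minimal , x-coprime) =
    insertColumn-kernel m w x x-ker ,
    ((i , punchIn w j) , xij≢0 ∘ trans (sym (insertColumn-old w x i j))) ,
    minimal ,
    λ d d∣x′ → x-coprime d (λ { (i , j) → subst (λ v → d ∣ ℤ.∣ v ∣)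
                                                (insertColumn-old w x i j) (d∣x′ (i , punchIn w j)) })
    where
    minimal : ∀ y → InKernel (suc m) y → NonZeroVec y → SuppSub y (insertColumn w x) →
              SuppSub (insertColumn w x) y
    minimal y y-ker ((i₀ , u₀) , y₀≢0) y⊆x′ = x′⊆y
      where
      y-w≡0 : ∀ i → y (i , w) ≡ + 0
      y-w≡0 i = y⊆x′ (i , w) (insertColumn-new w x i)
      y′ : EVec m
      y′ = deleteColumn w y
      y′≢0 : NonZeroVec y′
      y′≢0 with columnView w u₀
      ... | new   = contradiction (y-w≡0 i₀) y₀≢0
      ... | old j = (i₀ , j) , y₀≢0
      y′⊆x : SuppSub y′ x
      y′⊆x (i , j) xij≡0 = y⊆x′ (i , punchIn w j) (trans (insertColumn-old w x i j) xij≡0)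
      x⊆y′ : SuppSub x y′
      x⊆y′ = x-minimal y′ (deleteColumn-kernel m w y y-ker y-w≡0) y′≢0 y′⊆x
      x′⊆y : SuppSub (insertColumn w x) y
      x′⊆y (i , u) yiu≡0 with columnView w u
      ... | new   = insertColumn-new w x i
      ... | old j = trans (insertColumn-old w x i j) (x⊆y′ (i , j) yiu≡0)

  insertColumn-zero : ∀ {m} w (v : EVec m) → (∀ e → v e ≡ + 0) → ∀ e → insertColumn w v e ≡ + 0
  insertColumn-zero w v v≡0 (i , u) with columnView w u
  ... | new   = insertColumn-new w v i
  ... | old j = trans (insertColumn-old w v i j) (v≡0 (i , j))

  lincomb-insertColumn : ∀ {m} w k (c : Fin k → ℤ) (v : Fin k → EVec m) e →
    lincomb k c (λ t → insertColumn w (v t)) e ≡ insertColumn w (lincomb k c v) e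
  lincomb-insertColumn w k c v (i , u) with columnView w u
  ... | new = begin
    ∑ k (λ t → c t * insertColumn w (v t) (i , w))
      ≡⟨ ∑-zero k (λ t → trans (cong (c t *_) (insertColumn-new w (v t) i)) (ℤP.*-zeroʳ (c t))) ⟩
    + 0                                              ≡⟨ insertColumn-new w (lincomb k c v) i ⟨
    insertColumn w (lincomb k c v) (i , w)           ∎
  ... | old j = begin
    ∑ k (λ t → c t * insertColumn w (v t) (i , punchIn w j))
      ≡⟨ ∑-cong k (λ t → cong (c t *_) (insertColumn-old w (v t) i j)) ⟩
    lincomb k c v (i , j)                                     ≡⟨ insertColumn-old w (lincomb k c v) i j ⟨
    insertColumn w (lincomb k c v) (i , punchIn w j)          ∎

  insertColumn-cyc : ∀ {m} w (j1 j2 j3 : Fin m) e →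
    insertColumn w (cyc j1 j2 j3) e ≡ cyc (punchIn w j1) (punchIn w j2) (punchIn w j3) e
  insertColumn-cyc w j1 j2 j3 (i , u) with columnView w u
  ... | new = begin
    insertColumn w (cyc j1 j2 j3) (i , w)  ≡⟨ insertColumn-new w (cyc j1 j2 j3) i ⟩
    + 0                                    ≡⟨ cycEntry-zero i ⟨
    cycEntry i (+ 0) (+ 0) (+ 0)           ≡⟨ cycEntry-cong i (sym (δ-new w j1)) (sym (δ-new w j2)) (sym (δ-new w j3)) ⟩
    cyc (punchIn w j1) (punchIn w j2) (punchIn w j3) (i , w) ∎
  ... | old j = begin
    insertColumn w (cyc j1 j2 j3) (i , punchIn w j)  ≡⟨ insertColumn-old w (cyc j1 j2 j3) i j ⟩
    cyc j1 j2 j3 (i , j)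
      ≡⟨ cycEntry-cong i (sym (δ-punchIn w j j1)) (sym (δ-punchIn w j j2)) (sym (δ-punchIn w j j3)) ⟩
    cyc (punchIn w j1) (punchIn w j2) (punchIn w j3) (i , punchIn w j) ∎

  snoc : ∀ {A : Set} {n} → Vector A n → A → Vector A (suc n)
  snoc xs a = insertAt xs (fromℕ _) a

  snoc-last : ∀ {A : Set} {n} (xs : Vector A n) a → snoc xs a (fromℕ n) ≡ a
  snoc-last xs a = insertAt-lookup xs (fromℕ _) a

  snoc-inject₁ : ∀ {A : Set} {n} (xs : Vector A n) a i → snoc xs a (inject₁ i) ≡ xs i
  snoc-inject₁ xs a i = subst (λ k → insertAt xs (fromℕ _) a k ≡ xs i)
                              (punchIn-fromℕ i) (insertAt-punchIn xs (fromℕ _) a i)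
    where
    punchIn-fromℕ : ∀ {n} (i : Fin n) → punchIn (fromℕ n) i ≡ inject₁ i
    punchIn-fromℕ zero    = refl
    punchIn-fromℕ (suc i) = cong suc (punchIn-fromℕ i)

  append₃ : ∀ {A : Set} {n} → Vector A n → A → A → A → Vector A (suc (suc (suc n)))
  append₃ f a₀ a₁ a₂ = snoc (snoc (snoc f a₀) a₁) a₂

  inject₃ : ∀ {n} → Fin n → Fin (suc (suc (suc n)))
  inject₃ i = inject₁ (inject₁ (inject₁ i))

  new₀ new₁ new₂ : ∀ {n} → Fin (suc (suc (suc n)))
  new₀ {n} = inject₁ (inject₁ (fromℕ n))
  new₁ {n} = inject₁ (fromℕ (suc n))
  new₂ {n} = fromℕ (suc (suc n))

  module _ {A : Set} {n : ℕ} (f : Vector A n) (a₀ a₁ a₂ : A) where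

    private
      f₀ : Vector A (suc n)
      f₀ = snoc f a₀
      f₁ : Vector A (suc (suc n))
      f₁ = snoc f₀ a₁

    append₃-old : ∀ i → append₃ f a₀ a₁ a₂ (inject₃ i) ≡ f i
    append₃-old i = begin
      snoc f₁ a₂ (inject₃ i)                ≡⟨ snoc-inject₁ f₁ a₂ (inject₁ (inject₁ i)) ⟩
      snoc f₀ a₁ (inject₁ (inject₁ i))      ≡⟨ snoc-inject₁ f₀ a₁ (inject₁ i) ⟩
      snoc f a₀ (inject₁ i)                 ≡⟨ snoc-inject₁ f a₀ i ⟩
      f i                                   ∎

    append₃-new₀ : append₃ f a₀ a₁ a₂ new₀ ≡ a₀
    append₃-new₀ = trans (snoc-inject₁ f₁ a₂ (inject₁ (fromℕ n)))
                         (trans (snoc-inject₁ f₀ a₁ (fromℕ n)) (snoc-last f a₀))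

    append₃-new₁ : append₃ f a₀ a₁ a₂ new₁ ≡ a₁
    append₃-new₁ = trans (snoc-inject₁ f₁ a₂ (fromℕ (suc n))) (snoc-last f₀ a₁)

    append₃-new₂ : append₃ f a₀ a₁ a₂ new₂ ≡ a₂
    append₃-new₂ = snoc-last f₁ a₂

    append₃-elim : (P : Fin (suc (suc (suc n))) → A → Set) →
      (∀ i → P (inject₃ i) (f i)) → P new₀ a₀ → P new₁ a₁ → P new₂ a₂ →
      ∀ i → P i (append₃ f a₀ a₁ a₂ i)
    append₃-elim P pᵢ p₀ p₁ p₂ i with Top.view i
    ... | ‵fromℕ                        = subst (P _) (sym append₃-new₂) p₂
    ... | ‵inj₁ ‵fromℕ                  = subst (P _) (sym append₃-new₁) p₁
    ... | ‵inj₁ (‵inj₁ ‵fromℕ)          = subst (P _) (sym append₃-new₀) p₀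
    ... | ‵inj₁ (‵inj₁ (‵inject₁ j))    = subst (P _) (sym (append₃-old j)) (pᵢ j)

  append₃-eta : ∀ {A : Set} {n} (c : Vector A (suc (suc (suc n)))) i →
    c i ≡ append₃ (c ∘ inject₃) (c new₀) (c new₁) (c new₂) i
  append₃-eta c = append₃-elim (c ∘ inject₃) (c new₀) (c new₁) (c new₂) (λ i a → c i ≡ a)
    (λ _ → refl) refl refl refl

  lincomb-snoc : ∀ {m} k (c : Fin k → ℤ) a (v : Fin (suc k) → EVec m) e →
    lincomb (suc k) (snoc c a) v e ≡ lincomb k c (v ∘ inject₁) e + a * v (fromℕ k) e
  lincomb-snoc k c a v e = trans (∑-last k (λ i → snoc c a i * v i e))
    (cong₂ _+_ (∑-cong k (λ i → cong (_* v (inject₁ i) e) (snoc-inject₁ c a i)))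
               (cong (_* v (fromℕ k) e) (snoc-last c a)))

  lincomb-append₃ : ∀ {m} n (d : Fin n → ℤ) a₀ a₁ a₂ (v : Fin (suc (suc (suc n))) → EVec m) e →
    lincomb (suc (suc (suc n))) (append₃ d a₀ a₁ a₂) v e ≡
    lincomb n d (v ∘ inject₃) e + a₀ * v new₀ e + a₁ * v new₁ e + a₂ * v new₂ e
  lincomb-append₃ n d a₀ a₁ a₂ v e = begin
    lincomb (3 ℕ.+ n) (snoc (snoc (snoc d a₀) a₁) a₂) v e
      ≡⟨ lincomb-snoc (2 ℕ.+ n) (snoc (snoc d a₀) a₁) a₂ v e ⟩
    lincomb (2 ℕ.+ n) (snoc (snoc d a₀) a₁) (v ∘ inject₁) e + a₂ * v new₂ e
      ≡⟨ cong (_+ a₂ * v new₂ e) (lincomb-snoc (suc n) (snoc d a₀) a₁ (v ∘ inject₁) e) ⟩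
    lincomb (suc n) (snoc d a₀) (v ∘ inject₁ ∘ inject₁) e + a₁ * v new₁ e + a₂ * v new₂ e
      ≡⟨ cong (λ s → s + a₁ * v new₁ e + a₂ * v new₂ e) (lincomb-snoc n d a₀ (v ∘ inject₁ ∘ inject₁) e) ⟩
    lincomb n d (v ∘ inject₃) e + a₀ * v new₀ e + a₁ * v new₁ e + a₂ * v new₂ e
      ∎

  append₃-map : ∀ {A B : Set} {n} (g : A → B) (f : Vector A n) a₀ a₁ a₂ i →
    g (append₃ f a₀ a₁ a₂ i) ≡ append₃ (g ∘ f) (g a₀) (g a₁) (g a₂) i
  append₃-map g f a₀ a₁ a₂ =
    append₃-elim f a₀ a₁ a₂ (λ i a → g a ≡ append₃ (g ∘ f) (g a₀) (g a₁) (g a₂) i)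
      (λ i → sym (append₃-old (g ∘ f) _ _ _ i))
      (sym (append₃-new₀ (g ∘ f) _ _ _)) (sym (append₃-new₁ (g ∘ f) _ _ _)) (sym (append₃-new₂ (g ∘ f) _ _ _))

  lincomb-split₃ : ∀ {m} n (c : Fin (suc (suc (suc n))) → ℤ) (v : Fin (suc (suc (suc n))) → EVec m) e →
    lincomb (suc (suc (suc n))) c v e ≡
    lincomb n (c ∘ inject₃) (v ∘ inject₃) e + c new₀ * v new₀ e + c new₁ * v new₁ e + c new₂ * v new₂ e
  lincomb-split₃ n c v e =
    trans (∑-cong (suc (suc (suc n))) (λ i → cong (_* v i e) (append₃-eta c i)))
          (lincomb-append₃ n (c ∘ inject₃) (c new₀) (c new₁) (c new₂) v e)

  -- Odd numbers are coprime to 2 (so an odd divisor of 2h divides h).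
  odd⇒coprime-2 : ∀ {d} → Odd d → Coprime d 2
  odd⇒coprime-2 odd {zero}              (_ , 0∣2)  = contradiction (0∣⇒≡0 0∣2) λ ()
  odd⇒coprime-2 odd {suc zero}          _          = refl
  odd⇒coprime-2 odd {suc (suc zero)}    (2∣d , _)  = contradiction 2∣d odd
  odd⇒coprime-2 odd {suc (suc (suc e))} (_ , e∣2)  = contradiction (∣⇒≤ e∣2) λ { (ℕ.s≤s (ℕ.s≤s ())) }

  module Refinement {m n : ℕ} (w : Fin (suc m)) (j1 j2 j3 : Fin m)
                    (x : Fin (suc n) → EVec m) (h : Fin (suc n) → ℕ) where

    private
      u1 u2 u3 : Fin (suc m)
      u1 = punchIn w j1
      u2 = punchIn w j2
      u3 = punchIn w j3

      kept : Fin n → EVec (suc m)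
      kept i = insertColumn w (x (inject₁ i))

      y₀ y₁ y₂ : EVec (suc m)
      y₀ = cyc u1 w u3
      y₁ = cyc u1 u2 w
      y₂ = cyc w u2 u3

    refined : Fin (suc (suc (suc n))) → EVec (suc m)
    refined = append₃ kept y₀ y₁ y₂

    hₖ : ℕ
    hₖ = h (fromℕ n)

    doubledCoefficients : Fin n → ℕ
    doubledCoefficients i = 2 ℕ.* h (inject₁ i)

    refinedCoefficients : Fin (suc (suc (suc n))) → ℕ
    refinedCoefficients = append₃ doubledCoefficients hₖ hₖ hₖ

    module _ (j1≢j2 : j1 ≢ j2) (j2≢j3 : j2 ≢ j3) (j1≢j3 : j1 ≢ j3) where

      refined-circuits : (∀ i → IsCircuit m (x i)) → ∀ i → IsCircuit (suc m) (refined i)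
      refined-circuits x-circuits = append₃-elim _ _ _ _ (λ _ → IsCircuit (suc m))
        (λ i → insertColumn-isCircuit m w (x (inject₁ i)) (x-circuits (inject₁ i)))
        (Cycle.cyc-isCircuit u1 w u3 (punchInᵢ≢i w j1) (punchInᵢ≢i w j3 ∘ sym) (renamed j1≢j3))
        (Cycle.cyc-isCircuit u1 u2 w (renamed j1≢j2) (punchInᵢ≢i w j2) (punchInᵢ≢i w j1))
        (Cycle.cyc-isCircuit w u2 u3 (punchInᵢ≢i w j2 ∘ sym) (renamed j2≢j3) (punchInᵢ≢i w j3 ∘ sym))
        where
        renamed : ∀ {j j′} → j ≢ j′ → punchIn w j ≢ punchIn w j′
        renamed j≢j′ = j≢j′ ∘ punchIn-injective w _ _

    -- Column w of a combination of the refined family: only the three new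
    -- cycles meet the new vertex.
    refined-new-column : ∀ (c : Fin (suc (suc (suc n))) → ℤ) i →
      lincomb (suc (suc (suc n))) c refined (i , w) ≡
      + 0 + c new₀ * cycEntry i (+ 0) (+ 1) (+ 0) + c new₁ * cycEntry i (+ 0) (+ 0) (+ 1)
          + c new₂ * cycEntry i (+ 1) (+ 0) (+ 0)
    refined-new-column c i = begin
      lincomb (suc (suc (suc n))) c refined (i , w)
        ≡⟨ lincomb-split₃ n c refined (i , w) ⟩
      lincomb n (c ∘ inject₃) (refined ∘ inject₃) (i , w) + c new₀ * refined new₀ (i , w)
          + c new₁ * refined new₁ (i , w) + c new₂ * refined new₂ (i , w)
        ≡⟨ cong₂ _+_ (cong₂ _+_ (cong₂ _+_ kept-part (entry new₀ (append₃-new₀ kept y₀ y₁ y₂)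
                                                (δ-new w j1) (δ-refl w) (δ-new w j3)))
                                (entry new₁ (append₃-new₁ kept y₀ y₁ y₂) (δ-new w j1) (δ-new w j2) (δ-refl w)))
                     (entry new₂ (append₃-new₂ kept y₀ y₁ y₂) (δ-refl w) (δ-new w j2) (δ-new w j3)) ⟩
      + 0 + c new₀ * cycEntry i (+ 0) (+ 1) (+ 0) + c new₁ * cycEntry i (+ 0) (+ 0) (+ 1)
          + c new₂ * cycEntry i (+ 1) (+ 0) (+ 0) ∎
      where
      kept-part : lincomb n (c ∘ inject₃) (refined ∘ inject₃) (i , w) ≡ + 0
      kept-part = ∑-zero n (λ t → trans (cong (λ v → c (inject₃ t) * v (i , w)) (append₃-old kept y₀ y₁ y₂ t))
                                (trans (cong (c (inject₃ t) *_) (insertColumn-new w (x (inject₁ t)) i))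
                                       (ℤP.*-zeroʳ (c (inject₃ t)))))
      entry : ∀ k {k1 k2 k3 p q r} → refined k ≡ cyc k1 k2 k3 →
              δ w k1 ≡ p → δ w k2 ≡ q → δ w k3 ≡ r → c k * refined k (i , w) ≡ c k * cycEntry i p q r
      entry k eq e1 e2 e3 = cong (c k *_) (trans (cong (λ v → v (i , w)) eq) (cycEntry-cong i e1 e2 e3))

    -- If a combination vanishes on column w, rows b and c of that column force
    -- equal weights on the three new cycles.
    equal-weights : ∀ (c : Fin (suc (suc (suc n))) → ℤ) →
      (∀ i → lincomb (suc (suc (suc n))) c refined (i , w) ≡ + 0) →
      ∀ i → c i ≡ append₃ (c ∘ inject₃) (c new₀) (c new₀) (c new₀) i
    equal-weights c c-rel i =
      trans (append₃-eta c i) (cong₂ (λ β γ → append₃ (c ∘ inject₃) α β γ i) weight₁ weight₂)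
      where
      α : ℤ
      α = c new₀
      column : ∀ i → + 0 + α * cycEntry i (+ 0) (+ 1) (+ 0) + c new₁ * cycEntry i (+ 0) (+ 0) (+ 1)
                         + c new₂ * cycEntry i (+ 1) (+ 0) (+ 0) ≡ + 0
      column i = trans (sym (refined-new-column c i)) (c-rel i)
      weight₂ : c new₂ ≡ α
      weight₂ = sym (ℤP.i-j≡0⇒i≡j α (c new₂) (trans (row-b α (c new₁) (c new₂)) (column (suc zero))))
        where row-b : ∀ p q r → p - r ≡ + 0 + p * + 1 + q * + 0 + r * - + 1
              row-b = solve-∀
      weight₁ : c new₁ ≡ α
      weight₁ = ℤP.i-j≡0⇒i≡j (c new₁) α (trans (row-c α (c new₁) (c new₂)) (column (suc (suc zero))))
        where row-c : ∀ p q r → q - p ≡ + 0 + p * - + 1 + q * + 1 + r * + 0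
              row-c = solve-∀

    module _ (x-last : x (fromℕ n) ≡ cyc j1 j2 j3) where

      refined-lincomb : ∀ (d : Fin n → ℤ) α e →
        lincomb (suc (suc (suc n))) (append₃ d α α α) refined e ≡
        insertColumn w (lincomb (suc n) (snoc d (+ 2 * α)) x) e
      refined-lincomb d α e = begin
        lincomb (suc (suc (suc n))) (append₃ d α α α) refined e
          ≡⟨ lincomb-append₃ n d α α α refined e ⟩
        S′ + α * refined new₀ e + α * refined new₁ e + α * refined new₂ e
          ≡⟨ cong₂ _+_ (cong₂ _+_ (cong₂ _+_ old-part (cong (λ v → α * v e) (append₃-new₀ kept y₀ y₁ y₂)))
                                  (cong (λ v → α * v e) (append₃-new₁ kept y₀ y₁ y₂)))
                       (cong (λ v → α * v e) (append₃-new₂ kept y₀ y₁ y₂)) ⟩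
        S + α * y₀ e + α * y₁ e + α * y₂ e
          ≡⟨ factor S α (y₀ e) (y₁ e) (y₂ e) ⟩
        S + α * (y₀ e + y₁ e + y₂ e)
          ≡⟨ cong (λ t → S + α * t) (cyc-split w u1 u2 u3 e) ⟩
        S + α * (+ 2 * cyc u1 u2 u3 e)
          ≡⟨ cong (λ t → S + α * (+ 2 * t)) (insertColumn-cyc w j1 j2 j3 e) ⟨
        S + α * (+ 2 * insertColumn w (cyc j1 j2 j3) e)
          ≡⟨ cong (λ v → S + α * (+ 2 * insertColumn w v e)) x-last ⟨
        S + α * (+ 2 * insertColumn w (x (fromℕ n)) e)
          ≡⟨ double S α _ ⟩
        S + + 2 * α * insertColumn w (x (fromℕ n)) e
          ≡⟨ lincomb-snoc n d (+ 2 * α) (λ i → insertColumn w (x i)) e ⟨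
        lincomb (suc n) (snoc d (+ 2 * α)) (λ i → insertColumn w (x i)) e
          ≡⟨ lincomb-insertColumn w (suc n) (snoc d (+ 2 * α)) x e ⟩
        insertColumn w (lincomb (suc n) (snoc d (+ 2 * α)) x) e
          ∎
        where
        S′ S : ℤ
        S′ = lincomb n d (refined ∘ inject₃) e
        S = lincomb n d kept e
        old-part : S′ ≡ S
        old-part = ∑-cong n (λ i → cong (λ v → d i * v e) (append₃-old kept y₀ y₁ y₂ i))
        factor : ∀ s a p q r → s + a * p + a * q + a * r ≡ s + a * (p + q + r)
        factor = solve-∀
        double : ∀ s a t → s + a * (+ 2 * t) ≡ s + + 2 * a * t
        double = solve-∀

      refined-relation : (∀ e → lincomb (suc n) (λ i → + h i) x e ≡ + 0) →
        ∀ e → lincomb (suc (suc (suc n))) (λ i → + refinedCoefficients i) refined e ≡ + 0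
      refined-relation x-rel e = begin
        lincomb (suc (suc (suc n))) (λ i → + refinedCoefficients i) refined e
          ≡⟨ ∑-cong (suc (suc (suc n))) (λ i → cong (_* refined i e)
               (append₃-map +_ doubledCoefficients hₖ hₖ hₖ i)) ⟩
        lincomb (suc (suc (suc n))) (append₃ d (+ hₖ) (+ hₖ) (+ hₖ)) refined e
          ≡⟨ refined-lincomb d (+ hₖ) e ⟩
        insertColumn w (lincomb (suc n) (snoc d (+ 2 * + hₖ)) x) e
          ≡⟨ insertColumn-zero w _ doubled-relation e ⟩
        + 0 ∎
        where
        d : Fin n → ℤ
        d i = + (2 ℕ.* h (inject₁ i))
        doubled : ∀ i → snoc d (+ 2 * + hₖ) i ≡ + 2 * + h i
        doubled i with Top.view i
        ... | ‵fromℕ     = snoc-last d (+ 2 * + hₖ)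
        ... | ‵inject₁ j = trans (snoc-inject₁ d (+ 2 * + hₖ) j) (ℤP.pos-* 2 (h (inject₁ j)))
        doubled-relation : ∀ e → lincomb (suc n) (snoc d (+ 2 * + hₖ)) x e ≡ + 0
        doubled-relation e = begin
          ∑ (suc n) (λ i → snoc d (+ 2 * + hₖ) i * x i e)
            ≡⟨ ∑-cong (suc n) (λ i → trans (cong (_* x i e) (doubled i)) (ℤP.*-assoc (+ 2) (+ h i) (x i e))) ⟩
          ∑ (suc n) (λ i → + 2 * (+ h i * x i e))
            ≡⟨ ∑-scale (suc n) (+ 2) (λ i → + h i * x i e) ⟩
          + 2 * lincomb (suc n) (λ i → + h i) x e
            ≡⟨ cong (+ 2 *_) (x-rel e) ⟩
          + 0 ∎

      refined-independent :
        (∀ (j : Fin (suc n)) (c : Fin (suc n) → ℤ) → c j ≡ + 0 →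
           (∀ e → lincomb (suc n) c x e ≡ + 0) → ∀ i → c i ≡ + 0) →
        ∀ (j₀ : Fin (suc (suc (suc n)))) (c : Fin (suc (suc (suc n))) → ℤ) → c j₀ ≡ + 0 →
          (∀ e → lincomb (suc (suc (suc n))) c refined e ≡ + 0) → ∀ i → c i ≡ + 0
      refined-independent x-independent j₀ c cj₀≡0 c-rel = c≡0
        where
        d : Fin n → ℤ
        d = c ∘ inject₃
        α : ℤ
        α = c new₀
        c-shape : ∀ i → c i ≡ append₃ d α α α i
        c-shape = equal-weights c (λ i → c-rel (i , w))
        c′ : Fin (suc n) → ℤ
        c′ = snoc d (+ 2 * α)
        collapsed-relation : ∀ e → lincomb (suc n) c′ x e ≡ + 0
        collapsed-relation (i , j) = begin
          lincomb (suc n) c′ x (i , j)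
            ≡⟨ insertColumn-old w (lincomb (suc n) c′ x) i j ⟨
          insertColumn w (lincomb (suc n) c′ x) (i , punchIn w j)
            ≡⟨ refined-lincomb d α (i , punchIn w j) ⟨
          lincomb (suc (suc (suc n))) (append₃ d α α α) refined (i , punchIn w j)
            ≡⟨ ∑-cong (suc (suc (suc n))) (λ k → cong (_* refined k (i , punchIn w j)) (c-shape k)) ⟨
          lincomb (suc (suc (suc n))) c refined (i , punchIn w j)
            ≡⟨ c-rel (i , punchIn w j) ⟩
          + 0 ∎
        vanishing : ∃ λ J → c′ J ≡ + 0
        vanishing = append₃-elim d α α α (λ _ a → a ≡ + 0 → ∃ λ J → c′ J ≡ + 0)
          (λ i dᵢ≡0 → inject₁ i , trans (snoc-inject₁ d (+ 2 * α) i) dᵢ≡0)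
          at-last at-last at-last j₀ (trans (sym (c-shape j₀)) cj₀≡0)
          where at-last : α ≡ + 0 → ∃ λ J → c′ J ≡ + 0
                at-last α≡0 = fromℕ n , trans (snoc-last d (+ 2 * α)) (cong (+ 2 *_) α≡0)
        c′≡0 : ∀ i → c′ i ≡ + 0
        c′≡0 = x-independent (proj₁ vanishing) c′ (proj₂ vanishing) collapsed-relation
        α≡0 : α ≡ + 0
        α≡0 with ℤP.i*j≡0⇒i≡0∨j≡0 (+ 2) (trans (sym (snoc-last d (+ 2 * α))) (c′≡0 (fromℕ n)))
        ... | inj₂ α≡0 = α≡0
        c≡0 : ∀ i → c i ≡ + 0
        c≡0 i = trans (c-shape i) (append₃-elim d α α α (λ _ a → a ≡ + 0)
          (λ k → trans (sym (snoc-inject₁ d (+ 2 * α) k)) (c′≡0 (inject₁ k))) α≡0 α≡0 α≡0 i)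

    refined-posCoprime : PosCoprime (suc n) h → Odd hₖ → PosCoprime (suc (suc (suc n))) refinedCoefficients
    refined-posCoprime (h-pos , h-coprime) hₖ-odd = positive , coprime
      where
      positive : ∀ i → 0 ℕ.< refinedCoefficients i
      positive = append₃-elim doubledCoefficients hₖ hₖ hₖ (λ _ k → 0 ℕ.< k)
        (λ i → ℕP.<-≤-trans (h-pos (inject₁ i)) (ℕP.m≤m+n _ _)) (h-pos _) (h-pos _) (h-pos _)
      -- a common divisor divides hₖ, so it is odd, so it divides each h i from 2 h i
      coprime : ∀ d → (∀ i → d ∣ refinedCoefficients i) → d ≡ 1
      coprime d d∣h′ = h-coprime d d∣h
        where
        d∣hₖ : d ∣ hₖ
        d∣hₖ = subst (d ∣_) (append₃-new₂ doubledCoefficients hₖ hₖ hₖ) (d∣h′ new₂)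
        d-odd : Odd d
        d-odd 2∣d = hₖ-odd (∣-trans 2∣d d∣hₖ)
        d∣h : ∀ i → d ∣ h i
        d∣h i with Top.view i
        ... | ‵fromℕ     = d∣hₖ
        ... | ‵inject₁ j = coprime-divisor (odd⇒coprime-2 d-odd)
                             (subst (d ∣_) (append₃-old doubledCoefficients hₖ hₖ hₖ j) (d∣h′ (inject₃ j)))

    refinement : j1 ≢ j2 → j2 ≢ j3 → j1 ≢ j3 →
      (∀ i → IsCircuit m (x i)) → PrimitiveRelation m (suc n) x h →
      x (fromℕ n) ≡ cyc j1 j2 j3 → Odd hₖ →
      (∀ i → IsCircuit (suc m) (refined i)) ×
      PrimitiveRelation (suc m) (suc (suc (suc n))) refined refinedCoefficients
    refinement j1≢j2 j2≢j3 j1≢j3 x-circuits (h-posCoprime , x-rel , x-independent) x-last hₖ-odd =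
      refined-circuits j1≢j2 j2≢j3 j1≢j3 x-circuits ,
      refined-posCoprime h-posCoprime hₖ-odd ,
      refined-relation x-last x-rel ,
      refined-independent x-last x-independent

    refined-new₂ : refined new₂ ≡ cyc w (punchIn w j2) (punchIn w j3)
    refined-new₂ = append₃-new₂ kept y₀ y₁ y₂

    refinedCoefficients-kept : ∀ i → refinedCoefficients (inject₃ i) ≡ 2 ℕ.* h (inject₁ i)
    refinedCoefficients-kept = append₃-old doubledCoefficients hₖ hₖ hₖ

    refinedCoefficients-new₀ : refinedCoefficients new₀ ≡ hₖ
    refinedCoefficients-new₀ = append₃-new₀ doubledCoefficients hₖ hₖ hₖ

    refinedCoefficients-new₁ : refinedCoefficients new₁ ≡ hₖ
    refinedCoefficients-new₁ = append₃-new₁ doubledCoefficients hₖ hₖ hₖ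

    refinedCoefficients-new₂ : refinedCoefficients new₂ ≡ hₖ
    refinedCoefficients-new₂ = append₃-new₂ doubledCoefficients hₖ hₖ hₖ

  -- The vertices u_{m−2}, u_{m−1}, u_m of K_{3,m} for m = p + 3 (0-based indices p, p+1, p+2).
  uₘ₋₂ uₘ₋₁ uₘ : ∀ p → Fin (suc (suc (suc p)))
  uₘ₋₂ p = inject₁ (inject₁ (fromℕ p))
  uₘ₋₁ p = inject₁ (fromℕ (suc p))
  uₘ   p = fromℕ (suc (suc p))

  uₘ₋₂≢uₘ₋₁ : ∀ p → uₘ₋₂ p ≢ uₘ₋₁ p
  uₘ₋₂≢uₘ₋₁ zero    ()
  uₘ₋₂≢uₘ₋₁ (suc p) eq = uₘ₋₂≢uₘ₋₁ p (suc-injective eq)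

  uₘ₋₁≢uₘ : ∀ p → uₘ₋₁ p ≢ uₘ p
  uₘ₋₁≢uₘ zero    ()
  uₘ₋₁≢uₘ (suc p) eq = uₘ₋₁≢uₘ p (suc-injective eq)

  uₘ₋₂≢uₘ : ∀ p → uₘ₋₂ p ≢ uₘ p
  uₘ₋₂≢uₘ zero    ()
  uₘ₋₂≢uₘ (suc p) eq = uₘ₋₂≢uₘ p (suc-injective eq)

  -- Inserting the new vertex at the index of u_{m−1} makes it the u_{m−1} of
  -- K_{3,m+1}, and shifts the old u_{m−1}, u_m to u_m, u_{m+1}.
  punchIn-uₘ₋₁ : ∀ p → punchIn (uₘ₋₂ (suc p)) (uₘ₋₁ p) ≡ uₘ₋₁ (suc p)
  punchIn-uₘ₋₁ zero    = refl
  punchIn-uₘ₋₁ (suc p) = cong suc (punchIn-uₘ₋₁ p)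

  punchIn-uₘ : ∀ p → punchIn (uₘ₋₂ (suc p)) (uₘ p) ≡ uₘ (suc p)
  punchIn-uₘ zero    = refl
  punchIn-uₘ (suc p) = cong suc (punchIn-uₘ p)

open Circuits

open import Data.Nat using (ℕ; suc; _*_)
open import Data.Fin using (Fin; inject₁; fromℕ)
open import Data.Product using (Σ; _×_; _,_; proj₁; proj₂)
open import Relation.Binary.PropositionalEquality using (_≡_; sym; trans; cong₂; subst)

lemma2p5 : (p n : ℕ) →
    let m = suc (suc (suc p)) in
    (x : Fin (suc n) → EVec m) (h : Fin (suc n) → ℕ) →
    (∀ i → IsCircuit m (x i)) →
    PrimitiveRelation m (suc n) x h →
    x (fromℕ n) ≡ cyc (inject₁ (inject₁ (fromℕ p))) (inject₁ (fromℕ (suc p))) (fromℕ (suc (suc p))) →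
    Odd (h (fromℕ n)) →
    Σ (Fin (suc (suc (suc n))) → EVec (suc m)) λ xb →
    Σ (Fin (suc (suc (suc n))) → ℕ) λ hb →
      (∀ i → IsCircuit (suc m) (xb i)) ×
      PrimitiveRelation (suc m) (suc (suc (suc n))) xb hb ×
      xb (fromℕ (suc (suc n))) ≡ cyc (inject₁ (inject₁ (fromℕ (suc p)))) (inject₁ (fromℕ (suc (suc p)))) (fromℕ (suc (suc (suc p)))) ×
      Odd (hb (fromℕ (suc (suc n)))) ×
      (∀ (i : Fin n) → hb (inject₁ (inject₁ (inject₁ i))) ≡ 2 * h (inject₁ i)) ×
      hb (fromℕ (suc (suc n))) ≡ h (fromℕ n) ×
      hb (inject₁ (fromℕ (suc n))) ≡ h (fromℕ n) ×
      hb (inject₁ (inject₁ (fromℕ n))) ≡ h (fromℕ n)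
lemma2p5 p n x h x-circuits x-primitive x-last hₖ-odd =
  refined , refinedCoefficients , proj₁ refined-family , proj₂ refined-family , last-cycle ,
  subst Odd (sym refinedCoefficients-new₂) hₖ-odd ,
  refinedCoefficients-kept , refinedCoefficients-new₂ , refinedCoefficients-new₁ , refinedCoefficients-new₀
  where
  -- insert the new vertex at the index of u_{m−1}
  open Refinement (uₘ₋₂ (suc p)) (uₘ₋₂ p) (uₘ₋₁ p) (uₘ p) x h
  refined-family : (∀ i → IsCircuit (suc (suc (suc (suc p)))) (refined i)) ×
                   PrimitiveRelation (suc (suc (suc (suc p)))) (suc (suc (suc n))) refined refinedCoefficients
  refined-family =
    refinement (uₘ₋₂≢uₘ₋₁ p) (uₘ₋₁≢uₘ p) (uₘ₋₂≢uₘ p) x-circuits x-primitive x-last hₖ-odd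
  last-cycle : refined new₂ ≡ cyc (uₘ₋₂ (suc p)) (uₘ₋₁ (suc p)) (uₘ (suc p))
  last-cycle = trans refined-new₂ (cong₂ (cyc (uₘ₋₂ (suc p))) (punchIn-uₘ₋₁ p) (punchIn-uₘ p))
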